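{- Let $\mathcal{G}=(V,\mathcal{E})$ be an $\ell$-uniform hypergraph with $m$ edges and $n$ vertices, where $n\ge 3\ell$. Then there is a partition $V=V_1\,\dot\cup\, V_2$ with $|V_1|=\lfloor 2n/3\rfloor$ and $|V_2|=\lceil n/3\rceil$ such that at least $m\ell/2^{\ell+2}$ edges of $\mathcal{E}$ have exactly one vertex in $V_2$. -}

module Defs where

open import Data.Nat using (ℕ; _+_; _*_; _^_; _/_; _≤_)
open import Data.Fin using (Fin)
open import Data.Fin.Subset using (Subset; ∣_∣; _∩_; ∁)
open import Data.List using (List; length; filter)
open import Data.List.Relation.Unary.All using (All)
open import Data.List.Relation.Unary.Unique.Propositional using (Unique)
open import Data.Nat.Properties using (_≟_)
open import Relation.Binary.PropositionalEquality using (_≡_)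
open import Data.Product using (_×_)

record UniformHypergraph (n ℓ : ℕ) : Set where
  field
    edges   : List (Subset n)
    unique  : Unique edges
    uniform : All (λ e → ∣ e ∣ ≡ ℓ) edges

open UniformHypergraph public

numEdges : ∀ {n ℓ} → UniformHypergraph n ℓ → ℕ
numEdges G = length (edges G)

edgesWithExactlyOneIn : ∀ {n ℓ} → UniformHypergraph n ℓ → Subset n → ℕ
edgesWithExactlyOneIn G V₂ = length (filter (λ e → ∣ e ∩ V₂ ∣ ≟ 1) (edges G))

⌊2n/3⌋ : ℕ → ℕ
⌊2n/3⌋ n = (2 * n) / 3

⌈n/3⌉ : ℕ → ℕ
⌈n/3⌉ n = (n + 2) / 3

-- The proof averages over all k-element vertex sets S, where k = ⌈n/3⌉.  A
-- set e of size a meets exactly C(a,i)·C(n-a,j) of the (i+j)-sets in i points;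
-- with i = 1 and a = ℓ every edge meets ℓ·C(n-ℓ,k-1) of the k-sets in a single
-- vertex.  Double counting the pairs (e, S) with |e ∩ S| = 1 therefore gives
-- Σ_S #{e : |e ∩ S| = 1} = m·ℓ·C(n-ℓ,k-1), and some S is at least the average.
-- What remains is the binomial estimate C(n,k) ≤ 2^(ℓ+2)·C(n-ℓ,k-1): the
-- absorption identity gives C(n,k) ≤ 3·C(n-1,k-1) because n ≤ 3k, and since
-- k-1 lies below the middle, removing each of the further ℓ-1 points at most
-- halves the binomial coefficient.

module Submission where

open import Defs
open import Data.Bool.Base using (true; false)
open import Data.Fin.Subset using (Subset; ∣_∣; _∩_; ∁; inside; outside)
open import Data.Fin.Subset.Properties using (∣∁p∣≡n∸∣p∣)
open import Data.List.Base using (List; []; _∷_; _++_; map; length; filter)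
open import Data.List.Properties using (length-map; length-++; filter-++; filter-none; map-cong)
open import Data.List.Relation.Unary.All as All using (All; []; _∷_)
open import Data.List.Relation.Unary.All.Properties using (++⁺; map⁺)
open import Data.List.Relation.Unary.Any as Any using (Any; here; there)
open import Data.Nat.Base
open import Data.Nat.ListAction using (sum)
open import Data.Nat.Combinatorics using (_C_; nC1≡n; nCk+nC[k+1]≡[n+1]C[k+1])
open import Data.Nat.DivMod using (m/n≡1+[m∸n]/n)
open import Data.Nat.Properties
open import Data.Nat.Tactic.RingSolver using (solve-∀)
open import Data.Vec.Base using ([]; _∷_)
open import Data.Product.Base using (Σ; _×_; _,_; proj₁)
open import Relation.Binary.PropositionalEquality
open import Relation.Nullary using (Dec; yes; no; does; contradiction)
open import Relation.Unary using (Decidable)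

absorption : ∀ n k → suc k * (suc n C suc k) ≡ suc n * (n C k)
absorption zero    zero    = refl
absorption zero    (suc k) = *-zeroʳ (2 + k)
absorption (suc n) zero    = begin
  1 * ((2 + n) C 1) ≡⟨ *-identityˡ _ ⟩
  (2 + n) C 1       ≡⟨ nC1≡n (2 + n) ⟩
  2 + n             ≡⟨ *-identityʳ (2 + n) ⟨
  (2 + n) * 1       ∎
  where open ≡-Reasoning
absorption (suc n) (suc k) = begin
  (2 + k) * ((2 + n) C (2 + k))
    ≡⟨ cong ((2 + k) *_) (nCk+nC[k+1]≡[n+1]C[k+1] (suc n) (suc k)) ⟨
  (2 + k) * (x + suc n C (2 + k))
    ≡⟨ expand (suc k) x (suc n C (2 + k)) ⟩
  suc k * x + x + (2 + k) * (suc n C (2 + k))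
    ≡⟨ cong₂ (λ u v → u + x + v) (absorption n k) (absorption n (suc k)) ⟩
  suc n * (n C k) + x + suc n * (n C suc k)
    ≡⟨ cong (λ u → suc n * (n C k) + u + suc n * (n C suc k)) (nCk+nC[k+1]≡[n+1]C[k+1] n k) ⟨
  suc n * (n C k) + (n C k + n C suc k) + suc n * (n C suc k)
    ≡⟨ collect (suc n) (n C k) (n C suc k) ⟩
  (2 + n) * (n C k + n C suc k)
    ≡⟨ cong ((2 + n) *_) (nCk+nC[k+1]≡[n+1]C[k+1] n k) ⟩
  (2 + n) * x ∎
  where
  open ≡-Reasoning
  x : ℕ
  x = suc n C suc k
  expand : ∀ a u v → suc a * (u + v) ≡ a * u + u + suc a * v
  expand = solve-∀
  collect : ∀ a u v → a * u + (u + v) + a * v ≡ suc a * (u + v)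
  collect = solve-∀

absorption-bound : ∀ c n k → suc n ≤ c * suc k → suc n C suc k ≤ c * (n C k)
absorption-bound c n k h = *-cancelˡ-≤ (suc k) (begin
  suc k * (suc n C suc k) ≡⟨ absorption n k ⟩
  suc n * (n C k)         ≤⟨ *-monoˡ-≤ (n C k) h ⟩
  c * suc k * (n C k)     ≡⟨ swap-factors c (suc k) (n C k) ⟩
  suc k * (c * (n C k))   ∎)
  where
  open ≤-Reasoning
  swap-factors : ∀ a b u → a * b * u ≡ b * (a * u)
  swap-factors = solve-∀

weighted-pascal : ∀ r j → suc r * (suc r C j) ≡ j * (suc r C j) + suc r * (r C j)
weighted-pascal r zero    = refl
weighted-pascal r (suc i) = begin
  suc r * (suc r C suc i)                     ≡⟨ cong (suc r *_) (nCk+nC[k+1]≡[n+1]C[k+1] r i) ⟨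
  suc r * (r C i + r C suc i)                 ≡⟨ *-distribˡ-+ (suc r) (r C i) (r C suc i) ⟩
  suc r * (r C i) + suc r * (r C suc i)       ≡⟨ cong (_+ suc r * (r C suc i)) (absorption r i) ⟨
  suc i * (suc r C suc i) + suc r * (r C suc i) ∎
  where open ≡-Reasoning

C-doubling : ∀ r j → 2 * j ≤ suc r → suc r C j ≤ 2 * (r C j)
C-doubling r j h = *-cancelˡ-≤ (suc r) (+-cancelˡ-≤ (suc r * a) _ _ (begin
  suc r * a + suc r * a                   ≡⟨ cong₂ _+_ (weighted-pascal r j) (weighted-pascal r j) ⟩
  (j * a + suc r * b) + (j * a + suc r * b) ≡⟨ regroup j a (suc r) b ⟩
  (2 * j) * a + suc r * (2 * b)           ≤⟨ +-monoˡ-≤ (suc r * (2 * b)) (*-monoˡ-≤ a h) ⟩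
  suc r * a + suc r * (2 * b)             ∎))
  where
  open ≤-Reasoning
  a b : ℕ
  a = suc r C j
  b = r C j
  regroup : ∀ j a s b → (j * a + s * b) + (j * a + s * b) ≡ (2 * j) * a + s * (2 * b)
  regroup = solve-∀

C-deletion-bound : ∀ t r j → 2 * j ≤ suc r → (t + r) C j ≤ 2 ^ t * (r C j)
C-deletion-bound zero    r j h = ≤-reflexive (sym (+-identityʳ (r C j)))
C-deletion-bound (suc t) r j h = begin
  suc (t + r) C j       ≤⟨ C-doubling (t + r) j (≤-trans h (s≤s (m≤n+m r t))) ⟩
  2 * ((t + r) C j)     ≤⟨ *-monoʳ-≤ 2 (C-deletion-bound t r j h) ⟩
  2 * (2 ^ t * (r C j)) ≡⟨ *-assoc 2 (2 ^ t) (r C j) ⟨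
  2 ^ suc t * (r C j)   ∎
  where open ≤-Reasoning

below-middle : ∀ L r j → 3 * L ≤ L + r → 3 * suc j ≤ L + r + 2 → 2 * j ≤ suc r
below-middle L r j h₁ h₂ = *-cancelˡ-≤ 3 (+-cancelʳ-≤ 6 _ _ (begin
  3 * (2 * j) + 6     ≡⟨ six-j j ⟩
  2 * (3 * suc j)     ≤⟨ *-monoʳ-≤ 2 h₂ ⟩
  2 * (L + r + 2)     ≡⟨ twice L r ⟩
  2 * L + (2 * r + 4) ≤⟨ +-monoˡ-≤ (2 * r + 4) 2L≤r ⟩
  r + (2 * r + 4)     ≤⟨ m≤m+n (r + (2 * r + 4)) 5 ⟩
  r + (2 * r + 4) + 5 ≡⟨ nine r ⟩
  3 * suc r + 6       ∎))
  where
  open ≤-Reasoning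
  three : ∀ L → 3 * L ≡ L + 2 * L
  three = solve-∀
  2L≤r : 2 * L ≤ r
  2L≤r = +-cancelˡ-≤ L _ _ (subst (_≤ L + r) (three L) h₁)
  six-j : ∀ j → 3 * (2 * j) + 6 ≡ 2 * (3 * suc j)
  six-j = solve-∀
  twice : ∀ L r → 2 * (L + r + 2) ≡ 2 * L + (2 * r + 4)
  twice = solve-∀
  nine : ∀ r → r + (2 * r + 4) + 5 ≡ 3 * suc r + 6
  nine = solve-∀

C-middle-ratio : ∀ ℓ n j → 3 * suc ℓ ≤ n → n ≤ 3 * suc j → 3 * suc j ≤ n + 2 →
                 n C suc j ≤ 2 ^ (suc ℓ + 2) * ((n ∸ suc ℓ) C j)
C-middle-ratio ℓ n j h₁ h₂ h₃ with m≤n⇒∃[o]m+o≡n (≤-trans (m≤m+n (suc ℓ) _) h₁)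
... | r , refl rewrite m+n∸m≡n (suc ℓ) r = begin
  suc (ℓ + r) C suc j         ≤⟨ absorption-bound 3 (ℓ + r) j h₂ ⟩
  3 * ((ℓ + r) C j)           ≤⟨ *-monoʳ-≤ 3 (C-deletion-bound ℓ r j (below-middle (suc ℓ) r j h₁ h₃)) ⟩
  3 * (2 ^ ℓ * (r C j))       ≤⟨ *-monoˡ-≤ (2 ^ ℓ * (r C j)) (s≤s (s≤s (s≤s (z≤n {5})))) ⟩
  8 * (2 ^ ℓ * (r C j))       ≡⟨ eight (2 ^ ℓ) (r C j) ⟩
  2 * (2 ^ ℓ * 4) * (r C j)   ≡⟨ cong (λ p → 2 * p * (r C j)) (^-distribˡ-+-* 2 ℓ 2) ⟨
  2 ^ (suc ℓ + 2) * (r C j)   ∎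
  where
  open ≤-Reasoning
  eight : ∀ p u → 8 * (p * u) ≡ 2 * (p * 4) * u
  eight = solve-∀

C-positive : ∀ {n k} → k ≤ n → 0 < n C k
C-positive {k = zero}      _       = s≤s z≤n
C-positive {suc n} {suc k} (s≤s h) =
  ≤-trans (C-positive h) (≤-trans (m≤m+n (n C k) (n C suc k)) (≤-reflexive (nCk+nC[k+1]≡[n+1]C[k+1] n k)))

pascal-*ʳ : ∀ a i c → (a C i) * c + (a C suc i) * c ≡ (suc a C suc i) * c
pascal-*ʳ a i c = trans (sym (*-distribʳ-+ c (a C i) (a C suc i))) (cong (_* c) (nCk+nC[k+1]≡[n+1]C[k+1] a i))

pascal-*ˡ : ∀ c b j → c * (b C j) + c * (b C suc j) ≡ c * (suc b C suc j)
pascal-*ˡ c b j = trans (sym (*-distribˡ-+ c (b C j) (b C suc j))) (cong (c *_) (nCk+nC[k+1]≡[n+1]C[k+1] b j))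

subsetsOfSize : (n k : ℕ) → List (Subset n)
subsetsOfSize zero    zero    = [] ∷ []
subsetsOfSize zero    (suc k) = []
subsetsOfSize (suc n) zero    = map (outside ∷_) (subsetsOfSize n zero)
subsetsOfSize (suc n) (suc k) =
  map (inside ∷_) (subsetsOfSize n k) ++ map (outside ∷_) (subsetsOfSize n (suc k))

subsetsOfSize-size : ∀ n k → All (λ S → ∣ S ∣ ≡ k) (subsetsOfSize n k)
subsetsOfSize-size zero    zero    = refl ∷ []
subsetsOfSize-size zero    (suc k) = []
subsetsOfSize-size (suc n) zero    = map⁺ (subsetsOfSize-size n zero)
subsetsOfSize-size (suc n) (suc k) =
  ++⁺ (map⁺ (All.map (cong suc) (subsetsOfSize-size n k))) (map⁺ (subsetsOfSize-size n (suc k)))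

subsetsOfSize-length : ∀ n k → length (subsetsOfSize n k) ≡ n C k
subsetsOfSize-length zero    zero    = refl
subsetsOfSize-length zero    (suc k) = refl
subsetsOfSize-length (suc n) zero    =
  trans (length-map (outside ∷_) (subsetsOfSize n zero)) (subsetsOfSize-length n zero)
subsetsOfSize-length (suc n) (suc k) = begin
  length (map (inside ∷_) (subsetsOfSize n k) ++ map (outside ∷_) (subsetsOfSize n (suc k)))
    ≡⟨ length-++ (map (inside ∷_) (subsetsOfSize n k)) ⟩
  length (map (inside ∷_) (subsetsOfSize n k)) + length (map (outside ∷_) (subsetsOfSize n (suc k)))
    ≡⟨ cong₂ _+_ (length-map (inside ∷_) (subsetsOfSize n k)) (length-map (outside ∷_) (subsetsOfSize n (suc k))) ⟩
  length (subsetsOfSize n k) + length (subsetsOfSize n (suc k))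
    ≡⟨ cong₂ _+_ (subsetsOfSize-length n k) (subsetsOfSize-length n (suc k)) ⟩
  n C k + n C suc k
    ≡⟨ nCk+nC[k+1]≡[n+1]C[k+1] n k ⟩
  suc n C suc k ∎
  where open ≡-Reasoning

length-filter-map : ∀ {A B : Set} {P : B → Set} {Q : A → Set}
  (P? : Decidable P) (Q? : Decidable Q) (f : A → B) →
  (∀ x → does (P? (f x)) ≡ does (Q? x)) →
  ∀ xs → length (filter P? (map f xs)) ≡ length (filter Q? xs)
length-filter-map P? Q? f agree []       = refl
length-filter-map P? Q? f agree (x ∷ xs) with does (P? (f x)) | does (Q? x) | agree x
... | false | false | _ = length-filter-map P? Q? f agree xs
... | true  | true  | _ = cong suc (length-filter-map P? Q? f agree xs)

meeting : ∀ {n} → Subset n → ℕ → List (Subset n) → ℕ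
meeting e i Ss = length (filter (λ S → ∣ e ∩ S ∣ ≟ i) Ss)

meeting-++ : ∀ {n} (e : Subset n) i Ss Ts → meeting e i (Ss ++ Ts) ≡ meeting e i Ss + meeting e i Ts
meeting-++ e i Ss Ts = trans (cong length (filter-++ _ Ss Ts)) (length-++ (filter _ Ss))

meeting-avoid : ∀ {n} x (e : Subset n) i Ss → meeting (x ∷ e) i (map (outside ∷_) Ss) ≡ meeting e i Ss
meeting-avoid inside  e i = length-filter-map _ _ (outside ∷_) (λ _ → refl)
meeting-avoid outside e i = length-filter-map _ _ (outside ∷_) (λ _ → refl)

meeting-outside : ∀ {n} y (e : Subset n) i Ss → meeting (outside ∷ e) i (map (y ∷_) Ss) ≡ meeting e i Ss
meeting-outside y e i = length-filter-map _ _ (y ∷_) (λ _ → refl)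

meeting-hit : ∀ {n} (e : Subset n) i Ss → meeting (inside ∷ e) (suc i) (map (inside ∷_) Ss) ≡ meeting e i Ss
meeting-hit e i = length-filter-map _ _ (inside ∷_) (λ _ → refl)

meeting-hit-zero : ∀ {n} (e : Subset n) Ss → meeting (inside ∷ e) 0 (map (inside ∷_) Ss) ≡ 0
meeting-hit-zero e Ss = cong length (filter-none _ (map⁺ (All.universal (λ _ ()) Ss)))

meeting-split : ∀ {n} x (e : Subset n) i k →
  meeting (x ∷ e) i (subsetsOfSize (suc n) (suc k)) ≡
  meeting (x ∷ e) i (map (inside ∷_) (subsetsOfSize n k)) + meeting e i (subsetsOfSize n (suc k))
meeting-split {n} x e i k =
  trans (meeting-++ (x ∷ e) i (map (inside ∷_) (subsetsOfSize n k)) (map (outside ∷_) (subsetsOfSize n (suc k))))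
        (cong (meeting (x ∷ e) i (map (inside ∷_) (subsetsOfSize n k)) +_) (meeting-avoid x e i (subsetsOfSize n (suc k))))

meeting-step-inside : ∀ {n} (e : Subset n) i k →
  meeting (inside ∷ e) (suc i) (subsetsOfSize (suc n) (suc k)) ≡
  meeting e i (subsetsOfSize n k) + meeting e (suc i) (subsetsOfSize n (suc k))
meeting-step-inside {n} e i k =
  trans (meeting-split inside e (suc i) k)
        (cong (_+ meeting e (suc i) (subsetsOfSize n (suc k))) (meeting-hit e i (subsetsOfSize n k)))

meeting-step-inside₀ : ∀ {n} (e : Subset n) k →
  meeting (inside ∷ e) 0 (subsetsOfSize (suc n) (suc k)) ≡ meeting e 0 (subsetsOfSize n (suc k))
meeting-step-inside₀ {n} e k =
  trans (meeting-split inside e 0 k)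
        (cong (_+ meeting e 0 (subsetsOfSize n (suc k))) (meeting-hit-zero e (subsetsOfSize n k)))

meeting-step-outside : ∀ {n} (e : Subset n) i k →
  meeting (outside ∷ e) i (subsetsOfSize (suc n) (suc k)) ≡
  meeting e i (subsetsOfSize n k) + meeting e i (subsetsOfSize n (suc k))
meeting-step-outside {n} e i k =
  trans (meeting-split outside e i k)
        (cong (_+ meeting e i (subsetsOfSize n (suc k))) (meeting-outside inside e i (subsetsOfSize n k)))

meeting-too-many : ∀ n (e : Subset n) {i k} → k < i → meeting e i (subsetsOfSize n k) ≡ 0
meeting-too-many zero    []            {suc i} {zero}  _       = refl
meeting-too-many zero    []            {_}     {suc k} _       = refl
meeting-too-many (suc n) (x ∷ e)       {i}     {zero}  k<i     =
  trans (meeting-avoid x e i (subsetsOfSize n zero)) (meeting-too-many n e k<i)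
meeting-too-many (suc n) (inside ∷ e)  {suc i} {suc k} (s≤s k<i) =
  trans (meeting-step-inside e i k) (cong₂ _+_ (meeting-too-many n e k<i) (meeting-too-many n e (s≤s k<i)))
meeting-too-many (suc n) (outside ∷ e) {i}     {suc k} k<i     =
  trans (meeting-step-outside e i k)
        (cong₂ _+_ (meeting-too-many n e (≤-trans (n≤1+n (suc k)) k<i)) (meeting-too-many n e k<i))

meeting-count : ∀ n (e : Subset n) i j → meeting e i (subsetsOfSize n (i + j)) ≡ (∣ e ∣ C i) * (∣ ∁ e ∣ C j)
meeting-count zero    []            zero    zero    = refl
meeting-count zero    []            zero    (suc j) = refl
meeting-count zero    []            (suc i) j       = refl
meeting-count (suc n) (inside ∷ e)  zero    zero    =
  trans (meeting-avoid inside e 0 (subsetsOfSize n 0)) (meeting-count n e 0 0)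
meeting-count (suc n) (inside ∷ e)  zero    (suc j) =
  trans (meeting-step-inside₀ e j) (meeting-count n e 0 (suc j))
meeting-count (suc n) (inside ∷ e)  (suc i) j       = begin
  meeting (inside ∷ e) (suc i) (subsetsOfSize (suc n) (suc (i + j)))
    ≡⟨ meeting-step-inside e i (i + j) ⟩
  meeting e i (subsetsOfSize n (i + j)) + meeting e (suc i) (subsetsOfSize n (suc i + j))
    ≡⟨ cong₂ _+_ (meeting-count n e i j) (meeting-count n e (suc i) j) ⟩
  (∣ e ∣ C i) * (∣ ∁ e ∣ C j) + (∣ e ∣ C suc i) * (∣ ∁ e ∣ C j)
    ≡⟨ pascal-*ʳ ∣ e ∣ i (∣ ∁ e ∣ C j) ⟩
  (suc ∣ e ∣ C suc i) * (∣ ∁ e ∣ C j) ∎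
  where open ≡-Reasoning
meeting-count (suc n) (outside ∷ e) zero    zero    =
  trans (meeting-avoid outside e 0 (subsetsOfSize n 0)) (meeting-count n e 0 0)
meeting-count (suc n) (outside ∷ e) (suc i) zero    =
  trans (meeting-step-outside e (suc i) (i + 0))
        (cong₂ _+_ (meeting-too-many n e (s≤s (≤-reflexive (+-identityʳ i)))) (meeting-count n e (suc i) 0))
meeting-count (suc n) (outside ∷ e) i       (suc j) = begin
  meeting (outside ∷ e) i (subsetsOfSize (suc n) (i + suc j))
    ≡⟨ cong (λ k → meeting (outside ∷ e) i (subsetsOfSize (suc n) k)) (+-suc i j) ⟩
  meeting (outside ∷ e) i (subsetsOfSize (suc n) (suc (i + j)))
    ≡⟨ meeting-step-outside e i (i + j) ⟩
  meeting e i (subsetsOfSize n (i + j)) + meeting e i (subsetsOfSize n (suc (i + j)))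
    ≡⟨ cong (meeting e i (subsetsOfSize n (i + j)) +_) (cong (λ k → meeting e i (subsetsOfSize n k)) (+-suc i j)) ⟨
  meeting e i (subsetsOfSize n (i + j)) + meeting e i (subsetsOfSize n (i + suc j))
    ≡⟨ cong₂ _+_ (meeting-count n e i j) (meeting-count n e i (suc j)) ⟩
  (∣ e ∣ C i) * (∣ ∁ e ∣ C j) + (∣ e ∣ C i) * (∣ ∁ e ∣ C suc j)
    ≡⟨ pascal-*ˡ (∣ e ∣ C i) ∣ ∁ e ∣ j ⟩
  (∣ e ∣ C i) * (suc ∣ ∁ e ∣ C suc j) ∎
  where open ≡-Reasoning

indicator : ∀ {P : Set} → Dec P → ℕ
indicator (yes _) = 1
indicator (no _)  = 0

length-filter≡sum : ∀ {A : Set} {P : A → Set} (P? : Decidable P) xs →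
  length (filter P? xs) ≡ sum (map (λ x → indicator (P? x)) xs)
length-filter≡sum P? []       = refl
length-filter≡sum P? (x ∷ xs) with P? x
... | yes _ = cong suc (length-filter≡sum P? xs)
... | no _  = length-filter≡sum P? xs

sum-map-+ : ∀ {A : Set} (f g : A → ℕ) xs →
  sum (map (λ x → f x + g x) xs) ≡ sum (map f xs) + sum (map g xs)
sum-map-+ f g []       = refl
sum-map-+ f g (x ∷ xs) = begin
  f x + g x + sum (map (λ x → f x + g x) xs)        ≡⟨ cong (f x + g x +_) (sum-map-+ f g xs) ⟩
  f x + g x + (sum (map f xs) + sum (map g xs))      ≡⟨ interchange (f x) (g x) (sum (map f xs)) (sum (map g xs)) ⟩
  f x + sum (map f xs) + (g x + sum (map g xs))      ∎
  where
  open ≡-Reasoning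
  interchange : ∀ a b c d → a + b + (c + d) ≡ a + c + (b + d)
  interchange = solve-∀

sum-map-*ʳ : ∀ {A : Set} (f : A → ℕ) c xs → sum (map (λ x → f x * c) xs) ≡ sum (map f xs) * c
sum-map-*ʳ f c []       = refl
sum-map-*ʳ f c (x ∷ xs) =
  trans (cong (f x * c +_) (sum-map-*ʳ f c xs)) (sym (*-distribʳ-+ c (f x) (sum (map f xs))))

sum-map-const : ∀ {A : Set} (f : A → ℕ) c xs → All (λ x → f x ≡ c) xs → sum (map f xs) ≡ length xs * c
sum-map-const f c []       []         = refl
sum-map-const f c (x ∷ xs) (fx≡c ∷ h) = cong₂ _+_ fx≡c (sum-map-const f c xs h)

sum-swap : ∀ {A B : Set} (f : A → B → ℕ) as bs →
  sum (map (λ b → sum (map (λ a → f a b) as)) bs) ≡ sum (map (λ a → sum (map (f a) bs)) as)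
sum-swap f []       bs = trans (sum-map-const (λ _ → 0) 0 bs (All.universal (λ _ → refl) bs)) (*-zeroʳ (length bs))
sum-swap f (a ∷ as) bs =
  trans (sum-map-+ (f a) (λ b → sum (map (λ a → f a b) as)) bs) (cong (sum (map (f a) bs) +_) (sum-swap f as bs))

double-counting : ∀ {A B : Set} {R : A → B → Set} (R? : ∀ a b → Dec (R a b)) as bs →
  sum (map (λ b → length (filter (λ a → R? a b) as)) bs) ≡ sum (map (λ a → length (filter (R? a) bs)) as)
double-counting R? as bs = begin
  sum (map (λ b → length (filter (λ a → R? a b) as)) bs)
    ≡⟨ cong sum (map-cong (λ b → length-filter≡sum (λ a → R? a b) as) bs) ⟩
  sum (map (λ b → sum (map (λ a → indicator (R? a b)) as)) bs)
    ≡⟨ sum-swap (λ a b → indicator (R? a b)) as bs ⟩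
  sum (map (λ a → sum (map (λ b → indicator (R? a b)) bs)) as)
    ≡⟨ cong sum (map-cong (λ a → length-filter≡sum (R? a) bs) as) ⟨
  sum (map (λ a → length (filter (R? a) bs)) as) ∎
  where open ≡-Reasoning

above-average : ∀ {A : Set} (g : A → ℕ) a xs → 0 < length xs →
  length xs * a ≤ sum (map g xs) → Any (λ x → a ≤ g x) xs
above-average g a (x ∷ xs) _ h with a ≤? g x
... | yes a≤gx = here a≤gx
above-average g a (x ∷ [])     _ h | no a≰gx =
  contradiction (subst₂ _≤_ (+-identityʳ a) (+-identityʳ (g x)) h) a≰gx
above-average g a (x ∷ y ∷ xs) _ h | no a≰gx =
  there (above-average g a (y ∷ xs) (s≤s z≤n)
    (+-cancelˡ-≤ a _ _ (≤-trans h (+-monoˡ-≤ (sum (map g (y ∷ xs))) (<⇒≤ (≰⇒> a≰gx))))))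

/3-step : ∀ x → (3 + x) / 3 ≡ suc (x / 3)
/3-step x = m/n≡1+[m∸n]/n {3 + x} {3} (s≤s (s≤s (s≤s z≤n)))

⌈n/3⌉-step : ∀ n → ⌈n/3⌉ (3 + n) ≡ suc (⌈n/3⌉ n)
⌈n/3⌉-step n = /3-step (n + 2)

⌊2n/3⌋-step : ∀ n → ⌊2n/3⌋ (3 + n) ≡ 2 + ⌊2n/3⌋ n
⌊2n/3⌋-step n = begin
  2 * (3 + n) / 3       ≡⟨ cong (_/ 3) (*-distribˡ-+ 2 3 n) ⟩
  (3 + (3 + 2 * n)) / 3 ≡⟨ /3-step (3 + 2 * n) ⟩
  suc ((3 + 2 * n) / 3) ≡⟨ cong suc (/3-step (2 * n)) ⟩
  2 + (2 * n) / 3       ∎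
  where open ≡-Reasoning

⌊2n/3⌋+⌈n/3⌉≡n : ∀ n → ⌊2n/3⌋ n + ⌈n/3⌉ n ≡ n
⌊2n/3⌋+⌈n/3⌉≡n 0 = refl
⌊2n/3⌋+⌈n/3⌉≡n 1 = refl
⌊2n/3⌋+⌈n/3⌉≡n 2 = refl
⌊2n/3⌋+⌈n/3⌉≡n (suc (suc (suc n))) rewrite ⌊2n/3⌋-step n | ⌈n/3⌉-step n =
  cong (2 +_) (trans (+-suc (⌊2n/3⌋ n) (⌈n/3⌉ n)) (cong suc (⌊2n/3⌋+⌈n/3⌉≡n n)))

n≤3⌈n/3⌉ : ∀ n → n ≤ 3 * ⌈n/3⌉ n
n≤3⌈n/3⌉ 0 = z≤n
n≤3⌈n/3⌉ 1 = s≤s z≤n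
n≤3⌈n/3⌉ 2 = s≤s (s≤s z≤n)
n≤3⌈n/3⌉ (suc (suc (suc n))) rewrite ⌈n/3⌉-step n | *-suc 3 (⌈n/3⌉ n) = +-monoʳ-≤ 3 (n≤3⌈n/3⌉ n)

3⌈n/3⌉≤n+2 : ∀ n → 3 * ⌈n/3⌉ n ≤ n + 2
3⌈n/3⌉≤n+2 0 = z≤n
3⌈n/3⌉≤n+2 1 = s≤s (s≤s (s≤s z≤n))
3⌈n/3⌉≤n+2 2 = s≤s (s≤s (s≤s z≤n))
3⌈n/3⌉≤n+2 (suc (suc (suc n))) rewrite ⌈n/3⌉-step n | *-suc 3 (⌈n/3⌉ n) = +-monoʳ-≤ 3 (3⌈n/3⌉≤n+2 n)

complement-size : ∀ {n} (S : Subset n) → ∣ S ∣ ≡ ⌈n/3⌉ n → ∣ ∁ S ∣ ≡ ⌊2n/3⌋ n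
complement-size {n} S |S|≡k = begin
  ∣ ∁ S ∣                          ≡⟨ ∣∁p∣≡n∸∣p∣ S ⟩
  n ∸ ∣ S ∣                        ≡⟨ cong₂ _∸_ (sym (⌊2n/3⌋+⌈n/3⌉≡n n)) |S|≡k ⟩
  ⌊2n/3⌋ n + ⌈n/3⌉ n ∸ ⌈n/3⌉ n     ≡⟨ m+n∸n≡m (⌊2n/3⌋ n) (⌈n/3⌉ n) ⟩
  ⌊2n/3⌋ n                         ∎
  where open ≡-Reasoning

once-meeting-total : ∀ {n ℓ} (G : UniformHypergraph n ℓ) j →
  sum (map (edgesWithExactlyOneIn G) (subsetsOfSize n (suc j))) ≡ numEdges G * (ℓ * ((n ∸ ℓ) C j))
once-meeting-total {n} {ℓ} G j = begin
  sum (map (edgesWithExactlyOneIn G) (subsetsOfSize n (suc j)))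
    ≡⟨ double-counting (λ e S → ∣ e ∩ S ∣ ≟ 1) (edges G) (subsetsOfSize n (suc j)) ⟩
  sum (map (λ e → meeting e 1 (subsetsOfSize n (suc j))) (edges G))
    ≡⟨ sum-map-const (λ e → meeting e 1 (subsetsOfSize n (suc j))) (ℓ * ((n ∸ ℓ) C j)) (edges G)
                     (All.map (λ {e} → edge-count e) (uniform G)) ⟩
  numEdges G * (ℓ * ((n ∸ ℓ) C j)) ∎
  where
  open ≡-Reasoning
  edge-count : ∀ e → ∣ e ∣ ≡ ℓ → meeting e 1 (subsetsOfSize n (suc j)) ≡ ℓ * ((n ∸ ℓ) C j)
  edge-count e |e|≡ℓ = begin
    meeting e 1 (subsetsOfSize n (suc j)) ≡⟨ meeting-count n e 1 j ⟩
    (∣ e ∣ C 1) * (∣ ∁ e ∣ C j)           ≡⟨ cong₂ (λ a b → a * (b C j)) (nC1≡n ∣ e ∣) (∣∁p∣≡n∸∣p∣ e) ⟩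
    ∣ e ∣ * ((n ∸ ∣ e ∣) C j)             ≡⟨ cong (λ a → a * ((n ∸ a) C j)) |e|≡ℓ ⟩
    ℓ * ((n ∸ ℓ) C j)                     ∎

average-bound : ∀ {n ℓ} (G : UniformHypergraph n ℓ) k → 3 * ℓ ≤ n → n ≤ 3 * k → 3 * k ≤ n + 2 →
  length (subsetsOfSize n k) * (numEdges G * ℓ) ≤
  sum (map (λ S → edgesWithExactlyOneIn G S * 2 ^ (ℓ + 2)) (subsetsOfSize n k))
average-bound {n} {zero} G k _ _ _ = ≤-trans (≤-reflexive no-weight) z≤n
  where
  no-weight : length (subsetsOfSize n k) * (numEdges G * 0) ≡ 0
  no-weight = trans (cong (length (subsetsOfSize n k) *_) (*-zeroʳ (numEdges G))) (*-zeroʳ (length (subsetsOfSize n k)))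
average-bound {ℓ = suc ℓ} G zero h₁ h₂ _ = contradiction (≤-trans h₁ h₂) λ ()
average-bound {n} {suc ℓ} G (suc j) h₁ h₂ h₃ = begin
  length (subsetsOfSize n (suc j)) * (m * suc ℓ)  ≡⟨ cong (_* (m * suc ℓ)) (subsetsOfSize-length n (suc j)) ⟩
  (n C suc j) * (m * suc ℓ)                      ≤⟨ *-monoˡ-≤ (m * suc ℓ) (C-middle-ratio ℓ n j h₁ h₂ h₃) ⟩
  K * c * (m * suc ℓ)                            ≡⟨ rearrange K c m (suc ℓ) ⟩
  m * (suc ℓ * c) * K                            ≡⟨ cong (_* K) (once-meeting-total G j) ⟨
  sum (map (edgesWithExactlyOneIn G) Ss) * K     ≡⟨ sum-map-*ʳ (edgesWithExactlyOneIn G) K Ss ⟨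
  sum (map (λ S → edgesWithExactlyOneIn G S * K) Ss) ∎
  where
  open ≤-Reasoning
  m K c : ℕ
  m = numEdges G
  K = 2 ^ (suc ℓ + 2)
  c = (n ∸ suc ℓ) C j
  Ss : List (Subset n)
  Ss = subsetsOfSize n (suc j)
  rearrange : ∀ K c m l → K * c * (m * l) ≡ m * (l * c) * K
  rearrange = solve-∀

propositionB1 : (n ℓ : ℕ) → 3 * ℓ ≤ n → (G : UniformHypergraph n ℓ) →
    Σ (Subset n) (λ V₂ →
    (∣ ∁ V₂ ∣ ≡ ⌊2n/3⌋ n) × (∣ V₂ ∣ ≡ ⌈n/3⌉ n) ×
    (numEdges G * ℓ ≤ edgesWithExactlyOneIn G V₂ * 2 ^ (ℓ + 2)))
propositionB1 n ℓ 3ℓ≤n G = V₂ , complement-size V₂ (proj₁ size-and-bound) , size-and-bound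
  where
  k : ℕ
  k = ⌈n/3⌉ n
  Good : Subset n → Set
  Good S = numEdges G * ℓ ≤ edgesWithExactlyOneIn G S * 2 ^ (ℓ + 2)
  candidates : List (Subset n)
  candidates = subsetsOfSize n k
  k≤n : k ≤ n
  k≤n = subst (k ≤_) (⌊2n/3⌋+⌈n/3⌉≡n n) (m≤n+m k (⌊2n/3⌋ n))
  nonempty : 0 < length candidates
  nonempty = subst (0 <_) (sym (subsetsOfSize-length n k)) (C-positive k≤n)
  good : Any Good candidates
  good = above-average _ _ candidates nonempty (average-bound G k 3ℓ≤n (n≤3⌈n/3⌉ n) (3⌈n/3⌉≤n+2 n))
  V₂ : Subset n
  V₂ = Any.lookup good
  size-and-bound : ∣ V₂ ∣ ≡ k × Good V₂
  size-and-bound = All.lookupAny (subsetsOfSize-size n k) good
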